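{- Let $m\geq 0$ and $k\geq 2$ be integers, let $U_m=\{2p+1 : 0\leq p\leq m\}$, and let $v_0$ be a vertex of the circulant graph $C_{2(m+1)k}(U_m)$. Let $\varphi_{v_0}$ be the edge-coloring of $C_{2(m+1)k}(U_m)$ with colors in $\{l_i : 0\le i\le m\}\cup\{r_i: 0\le i\le m\}$ determined by the rules: (i) for $i\in\{0,\dots,m\}$, $\varphi_{v_0}(v_0+i,v_0+i+1)=r_i$ and $\varphi_{v_0}(v_0-i-1,v_0-i)=l_i$; (ii) for every vertex $v$, $\varphi_{v_0}(v+2m+2,v+2m+3)=\varphi_{v_0}(v,v+1)$; (iii) for every vertex $v$ and every $p\in\{0,\dots,m\}$, $\varphi_{v_0}(v-p,v+1+p)=\varphi_{v_0}(v,v+1)$. Then $\varphi_{v_0}$ is a proper edge-coloring of $C_{2(m+1)k}(U_m)$ using $2(m+1)$ colors.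
   Context: For $n\in\mathbb{N}^*$ and $S\subset\mathbb{Z}_n$, the circulant graph $C_n(S)$ is the simple undirected graph with vertex set $\mathbb{Z}_n$ in which $i$ and $j$ are adjacent if and only if $i-j\equiv \pm s\pmod n$ for some $s\in S$; vertex arithmetic is modulo $n$. A proper edge-coloring assigns colors to edges so that edges sharing an endpoint get different colors. -}

module Defs where

open import Data.Nat using (ℕ; suc; _≤_; NonZero) renaming (_+_ to _+ℕ_; _*_ to _*ℕ_)
open import Data.Integer using (ℤ; +_; _+_; _-_; _%ℕ_)
import Data.Nat.DivMod as ND
open import Data.Fin using (Fin; toℕ)
open import Data.Sum using (_⊎_; inj₁; inj₂)
open import Data.Product using (Σ; _×_; ∃; ∃-syntax)
open import Relation.Binary.PropositionalEquality using (_≡_; _≢_)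

-- Vertices of Z_n are Fin n.  Reduction of an integer modulo n:
⟦_⟧ : {n : ℕ} .{{_ : NonZero n}} → ℤ → Fin n
⟦_⟧ {n} z = ND._mod_ (z %ℕ n) n

ι : {n : ℕ} → Fin n → ℤ
ι i = + (toℕ i)

CircAdj : (n : ℕ) .{{_ : NonZero n}} → (S : ℤ → Set) → Fin n → Fin n → Set
CircAdj n S i j = (i ≢ j) × (∃[ s ] (S s × ((j ≡ ⟦ ι i + s ⟧) ⊎ (j ≡ ⟦ ι i - s ⟧))))

U : ℕ → ℤ → Set
U m s = ∃[ p ] ((p ≤ m) × (s ≡ + (2 *ℕ p +ℕ 1)))

Colour : ℕ → Set
Colour m = Fin (suc m) ⊎ Fin (suc m)

l r : {m : ℕ} → Fin (suc m) → Colour m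
l i = inj₁ i
r i = inj₂ i

-- An edge-colouring of a graph with adjacency Adj, given as a function on
-- ordered pairs that is symmetric on edges (values on non-edges irrelevant).
IsEdgeColouring : {V C : Set} → (V → V → Set) → (V → V → C) → Set
IsEdgeColouring {V} Adj φ = ∀ (u v : V) → Adj u v → φ u v ≡ φ v u

IsProper : {V C : Set} → (V → V → Set) → (V → V → C) → Set
IsProper {V} Adj φ = ∀ (u v w : V) → Adj u v → Adj u w → v ≢ w → φ u v ≢ φ u w

UsesAll : {V C : Set} → (V → V → Set) → (V → V → C) → Set
UsesAll {V} {C} Adj φ = ∀ (c : C) → ∃[ u ] ∃[ v ] (Adj u v × (φ u v ≡ c))

Rules : (m : ℕ) (n : ℕ) .{{_ : NonZero n}} → Fin n → (Fin n → Fin n → Colour m) → Set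
Rules m n v0 φ =
    (∀ (i : Fin (suc m)) →
        (φ ⟦ ι v0 + ι i ⟧ ⟦ ι v0 + ι i + + 1 ⟧ ≡ r i)
      × (φ ⟦ ι v0 - ι i - + 1 ⟧ ⟦ ι v0 - ι i ⟧ ≡ l i))
  × (∀ (v : Fin n) →
        φ ⟦ ι v + + (2 *ℕ m +ℕ 2) ⟧ ⟦ ι v + + (2 *ℕ m +ℕ 3) ⟧ ≡ φ v ⟦ ι v + + 1 ⟧)
  × (∀ (v : Fin n) (p : ℕ) → p ≤ m →
        φ ⟦ ι v - + p ⟧ ⟦ ι v + + 1 + + p ⟧ ≡ φ v ⟦ ι v + + 1 ⟧)

-- Put M = 2(m+1) and let colour : ℤ → Colour m be the colouring of integers
-- by their residue modulo M relative to v0: v0 + i ↦ r_i and v0 - i - 1 ↦ l_i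
-- for 0 ≤ i ≤ m.  It is injective modulo M.  Call an edge-colouring φ
-- *centred* when every edge {z, z + 2p + 1} (p ≤ m), read from z, gets
-- colour (z + p).  The proof has four parts:
--   * rules ⇒ centred: rule (ii) makes the colour of the unit edge {z, z+1}
--     M-periodic in z, rule (i) fixes it on a window of M consecutive z, so it
--     equals colour z; rule (iii) transfers this to the edge {z-p, z+p+1};
--   * centred ⇒ proper: the neighbours u + 2t + 1 of u (-(m+1) ≤ t ≤ m) get
--     colours colour (u + t), pairwise distinct since the t are distinct mod M;
--     every colour occurs already on a unit edge;
--   * the colouring that colours each edge from its short side is a symmetric
--     centred colouring (k ≥ 2 makes n larger than twice the longest jump);
--   * centred ⇒ rules, so this colouring witnesses existence.
module Submission where

open import Defs
open import Data.Nat using (ℕ; suc; _≤_; _*_; NonZero)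
open import Data.Fin using (Fin)
open import Data.Product using (_×_; ∃-syntax)

open import Data.Nat using (zero; _<_; _∸_; z≤n; s≤s; ⌊_/2⌋; _≤?_) renaming (_+_ to _+ℕ_)
import Data.Nat.Properties as ℕ
open import Data.Nat.Divisibility using (_∣_; divides)
open import Data.Nat.DivMod using (m<n⇒m%n≡m)
import Data.Nat.Tactic.RingSolver as ℕ-Solver
open import Data.Integer using (ℤ; +_; -[1+_]; +[1+_]; _+_; _-_; -_; _%ℕ_; _/ℕ_) renaming (_*_ to _*ℤ_)
open import Data.Integer.Properties using (pos-*; +-injective) renaming (*-assoc to *ℤ-assoc; +-assoc to +ℤ-assoc; +-comm to +ℤ-comm; +-identityʳ to +ℤ-identityʳ; *-identityˡ to *ℤ-identityˡ)
open import Data.Integer.DivMod using (n%ℕd<d; a≡a%ℕn+[a/ℕn]*n)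
open import Data.Integer.Tactic.RingSolver using (solve-∀)
open import Data.Fin using (toℕ; splitAt; join; opposite; _↑ˡ_; _↑ʳ_)
open import Data.Fin.Properties using (toℕ-injective; toℕ<n; toℕ≤pred[n]; toℕ-fromℕ<; toℕ-↑ˡ; toℕ-↑ʳ; splitAt-↑ˡ; splitAt-↑ʳ; join-splitAt; opposite-prop; opposite-involutive)
open import Data.Sum using (_⊎_; inj₁; inj₂; [_,_]′)
open import Data.Sum.Properties using (inj₁-injective; inj₂-injective)
open import Data.Product using (_,_; proj₁; proj₂; Σ-syntax)
open import Data.Empty using (⊥-elim)
open import Function using (_∘_)
open import Relation.Nullary using (¬_; yes; no; contradiction)
open import Relation.Binary.PropositionalEquality

private variable
  a b c d z : ℤ
  N d′ s : ℕ

infix 4 _≡_mod_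
record _≡_mod_ (a b : ℤ) (N : ℕ) : Set where
  constructor by-multiple
  field
    quotient   : ℤ
    difference : a ≡ b + quotient *ℤ + N

mod-reflexive : a ≡ b → a ≡ b mod N
mod-reflexive {a} {N = N} refl = by-multiple (+ 0) (zero-multiple a (+ N))
  where
    zero-multiple : ∀ a n → a ≡ a + + 0 *ℤ n
    zero-multiple = solve-∀

mod-refl : a ≡ a mod N
mod-refl = mod-reflexive refl

mod-sym : a ≡ b mod N → b ≡ a mod N
mod-sym {N = N} (by-multiple q eq) = by-multiple (- q) (flip eq)
  where
    flip : a ≡ b + q *ℤ + N → b ≡ a + (- q) *ℤ + N
    flip {b = b} refl = cancel b q (+ N)
      where
        cancel : ∀ b q n → b ≡ b + q *ℤ n + (- q) *ℤ n
        cancel = solve-∀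

mod-trans : a ≡ b mod N → b ≡ c mod N → a ≡ c mod N
mod-trans {N = N} {c = c} (by-multiple q refl) (by-multiple q′ refl) =
  by-multiple (q′ + q) (collect c q q′ (+ N))
  where
    collect : ∀ c q q′ n → c + q′ *ℤ n + q *ℤ n ≡ c + (q′ + q) *ℤ n
    collect = solve-∀

mod-+ : a ≡ b mod N → c ≡ d mod N → a + c ≡ b + d mod N
mod-+ {b = b} {N = N} {d = d} (by-multiple q refl) (by-multiple q′ refl) =
  by-multiple (q + q′) (collect b d q q′ (+ N))
  where
    collect : ∀ b d q q′ n → b + q *ℤ n + (d + q′ *ℤ n) ≡ b + d + (q + q′) *ℤ n
    collect = solve-∀

mod-neg : a ≡ b mod N → - a ≡ - b mod N
mod-neg {b = b} {N = N} (by-multiple q refl) = by-multiple (- q) (negate b q (+ N))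
  where
    negate : ∀ b q n → - (b + q *ℤ n) ≡ - b + (- q) *ℤ n
    negate = solve-∀

mod-cancelˡ : c + a ≡ c + b mod N → a ≡ b mod N
mod-cancelˡ {c} {a} {b} {N} (by-multiple q eq) = by-multiple q (cancel eq)
  where
    cancel : c + a ≡ c + b + q *ℤ + N → a ≡ b + q *ℤ + N
    cancel eq = trans (sym (shift c a)) (trans (cong (_- c) eq) (unshift c b q (+ N)))
      where
        shift : ∀ c a → c + a - c ≡ a
        shift = solve-∀
        unshift : ∀ c b q n → c + b + q *ℤ n - c ≡ b + q *ℤ n
        unshift = solve-∀

mod-negate : s ≤ N → - + s ≡ + (N ∸ s) mod N
mod-negate {s} {N} s≤N = by-multiple (- + 1)
  (trans (wrap (+ (N ∸ s)) (+ s)) (cong (λ t → + (N ∸ s) + - + 1 *ℤ + t) (ℕ.m∸n+n≡m s≤N)))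
  where
    wrap : ∀ d s → - s ≡ d + - + 1 *ℤ (d + s)
    wrap = solve-∀

mod-divisor : d′ ∣ N → a ≡ b mod N → a ≡ b mod d′
mod-divisor {d′} {b = b} (divides j refl) (by-multiple q eq) =
  by-multiple (q *ℤ + j) (trans eq (cong (λ t → b + t) regroup))
  where
    regroup : q *ℤ + (j * d′) ≡ q *ℤ + j *ℤ + d′
    regroup = trans (cong (q *ℤ_) (pos-* j d′)) (sym (*ℤ-assoc q (+ j) (+ d′)))

periodic-invariant : {A : Set} (f : ℤ → A) → (∀ z → f (z + + N) ≡ f z) →
                     a ≡ b mod N → f a ≡ f b
periodic-invariant {N} {b = b} f periodic (by-multiple q refl) = along q
  where
    forward : ∀ j x → f (x + + j *ℤ + N) ≡ f x
    forward zero x = cong f (+ℤ-identityʳ x)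
    forward (suc j) x = trans (cong f (step x (+ j) (+ N))) (trans (periodic _) (forward j x))
      where
        step : ∀ x j n → x + (+ 1 + j) *ℤ n ≡ x + j *ℤ n + n
        step = solve-∀
    along : ∀ q → f (b + q *ℤ + N) ≡ f b
    along (+ j) = forward j b
    along -[1+ j ] = sym (trans (cong f (back b (+ suc j) (+ N))) (forward (suc j) _))
      where
        back : ∀ b j n → b ≡ b + (- j) *ℤ n + j *ℤ n
        back = solve-∀

-- Residues: two naturals below N that are congruent modulo N are equal.  A
-- nonzero quotient would put one of them a positive multiple of N above the
-- other, hence at least N.
overshoots : ∀ {x y} j → x < N → + x ≢ + y + +[1+ j ] *ℤ + N
overshoots {N} {x} {y} j x<N eq = ℕ.<⇒≱ x<N (subst (N ≤_) (sym x≡) N≤)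
  where
    x≡ : x ≡ y +ℕ suc j * N
    x≡ = +-injective (trans eq (cong (λ t → + y + t) (sym (pos-* (suc j) N))))
    N≤ : N ≤ y +ℕ suc j * N
    N≤ = ℕ.≤-trans (ℕ.m≤m+n N (j * N)) (ℕ.m≤n+m _ y)

residue-unique : ∀ {x y} → x < N → y < N → + x ≡ + y mod N → x ≡ y
residue-unique _ _ (by-multiple (+ zero) eq) = trans (+-injective eq) (ℕ.+-identityʳ _)
residue-unique x<N _ (by-multiple +[1+ j ] eq) = ⊥-elim (overshoots j x<N eq)
residue-unique _ y<N h@(by-multiple -[1+ j ] _) =
  ⊥-elim (overshoots j y<N (_≡_mod_.difference (mod-sym h)))

module _ .{{_ : NonZero N}} where

  ι⟦⟧ : ∀ z → ι (⟦_⟧ {N} z) ≡ z mod N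
  ι⟦⟧ z = mod-sym (by-multiple (z /ℕ N) (trans (a≡a%ℕn+[a/ℕn]*n z N) (cong (λ t → + t + (z /ℕ N) *ℤ + N) (sym toℕ⟦z⟧))))
    where
      toℕ⟦z⟧ : toℕ (⟦_⟧ {N} z) ≡ z %ℕ N
      toℕ⟦z⟧ = trans (toℕ-fromℕ< _) (m<n⇒m%n≡m (n%ℕd<d z N))

  toℕ⟦⟧ : ∀ {x} → x < N → z ≡ + x mod N → toℕ (⟦_⟧ {N} z) ≡ x
  toℕ⟦⟧ {z} x<N h = residue-unique (toℕ<n _) x<N (mod-trans (ι⟦⟧ z) h)

  ⟦⟧-cong : a ≡ b mod N → ⟦_⟧ {N} a ≡ ⟦ b ⟧
  ⟦⟧-cong {a} {b} h = toℕ-injective (toℕ⟦⟧ (toℕ<n _) (mod-trans h (mod-sym (ι⟦⟧ b))))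

  ⟦⟧-reflects : ⟦_⟧ {N} a ≡ ⟦ b ⟧ → a ≡ b mod N
  ⟦⟧-reflects {a} {b} eq = mod-trans (mod-sym (ι⟦⟧ a)) (mod-trans (mod-reflexive (cong ι eq)) (ι⟦⟧ b))

  ⟦ι⟧ : (u : Fin N) → ⟦ ι u ⟧ ≡ u
  ⟦ι⟧ u = toℕ-injective (toℕ⟦⟧ (toℕ<n u) mod-refl)

  ⟦⟧-at : (u : Fin N) → z ≡ ι u mod N → ⟦ z ⟧ ≡ u
  ⟦⟧-at u h = trans (⟦⟧-cong h) (⟦ι⟧ u)

  vertex-ext : (u v : Fin N) → ι u ≡ ι v mod N → u ≡ v
  vertex-ext u v h = trans (sym (⟦ι⟧ u)) (⟦⟧-at v h)

module ResidueColouring (m : ℕ) (o : ℤ) where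

  M : ℕ
  M = suc m +ℕ suc m

  -- residues 0 … m give r_0 … r_m, residues m+1+j give l_{m-j}
  residueColour : Fin M → Colour m
  residueColour x = [ r , l ∘ opposite ]′ (splitAt (suc m) x)

  residueColour-injective : ∀ {x y} → residueColour x ≡ residueColour y → x ≡ y
  residueColour-injective {x} {y} eq = begin
    x                               ≡⟨ join-splitAt (suc m) (suc m) x ⟨
    join (suc m) (suc m) (splitAt (suc m) x) ≡⟨ cong (join (suc m) (suc m)) (side-injective (splitAt (suc m) x) (splitAt (suc m) y) eq) ⟩
    join (suc m) (suc m) (splitAt (suc m) y) ≡⟨ join-splitAt (suc m) (suc m) y ⟩
    y                               ∎
    where
      open ≡-Reasoning
      side-injective : ∀ s t → [ r , l ∘ opposite ]′ s ≡ [ r , l ∘ opposite ]′ t → s ≡ t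
      side-injective (inj₁ i) (inj₁ j) eq = cong inj₁ (inj₂-injective eq)
      side-injective (inj₂ i) (inj₂ j) eq = cong inj₂ (begin
        i                       ≡⟨ opposite-involutive i ⟨
        opposite (opposite i)   ≡⟨ cong opposite (inj₁-injective eq) ⟩
        opposite (opposite j)   ≡⟨ opposite-involutive j ⟩
        j                       ∎)
      side-injective (inj₁ _) (inj₂ _) ()
      side-injective (inj₂ _) (inj₁ _) ()

  opposite-sum : (i : Fin (suc m)) → ι i + ι (opposite i) ≡ + m
  opposite-sum i = cong +_ (trans (cong (toℕ i +ℕ_) (opposite-prop i)) (ℕ.m+[n∸m]≡n (toℕ≤pred[n] i)))

  colour : ℤ → Colour m
  colour z = residueColour ⟦ z - o ⟧

  colour-cong : a ≡ b mod M → colour a ≡ colour b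
  colour-cong h = cong residueColour (⟦⟧-cong (mod-+ h mod-refl))

  colour-injective : colour a ≡ colour b → a ≡ b mod M
  colour-injective {a} {b} eq = mod-trans (mod-reflexive (restore a o))
    (mod-trans (mod-+ (⟦⟧-reflects {a = a - o} {b - o} (residueColour-injective eq)) mod-refl) (mod-reflexive (sym (restore b o))))
    where
      restore : ∀ a o → a ≡ a - o + o
      restore = solve-∀

  colour-offset : (x : Fin M) → colour (o + ι x) ≡ residueColour x
  colour-offset x = cong residueColour (⟦⟧-at x (mod-reflexive (cancel o (ι x))))
    where
      cancel : ∀ o t → o + t - o ≡ t
      cancel = solve-∀

  upper-residue : ∀ (i j : Fin (suc m)) → ι i + ι j ≡ + m →
                  o + ι (suc m ↑ʳ j) ≡ o - ι i - + 1 mod M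
  upper-residue i j sum = by-multiple (+ 1)
    (trans (cong (λ t → o + + t) (toℕ-↑ʳ (suc m) j)) (wrap o (ι i) (ι j) (+ m) (sym sum)))
    where
      wrap : ∀ o i j m → m ≡ i + j → o + (+ 1 + m + j) ≡ o - i - + 1 + + 1 *ℤ (+ 1 + m + (+ 1 + m))
      wrap o i j m refl = wrap′ o i j
        where
          wrap′ : ∀ o i j → o + (+ 1 + (i + j) + j) ≡ o - i - + 1 + + 1 *ℤ (+ 1 + (i + j) + (+ 1 + (i + j)))
          wrap′ = solve-∀

  colour-right : (i : Fin (suc m)) → colour (o + ι i) ≡ r i
  colour-right i = begin
    colour (o + ι i)              ≡⟨ cong (λ t → colour (o + + t)) (toℕ-↑ˡ i (suc m)) ⟨
    colour (o + ι (i ↑ˡ suc m))   ≡⟨ colour-offset (i ↑ˡ suc m) ⟩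
    residueColour (i ↑ˡ suc m)    ≡⟨ cong [ r , l ∘ opposite ]′ (splitAt-↑ˡ (suc m) i (suc m)) ⟩
    r i                           ∎
    where open ≡-Reasoning

  colour-left : (i : Fin (suc m)) → colour (o - ι i - + 1) ≡ l i
  colour-left i = begin
    colour (o - ι i - + 1)                ≡⟨ colour-cong (upper-residue i (opposite i) (opposite-sum i)) ⟨
    colour (o + ι (suc m ↑ʳ opposite i))  ≡⟨ colour-offset (suc m ↑ʳ opposite i) ⟩
    residueColour (suc m ↑ʳ opposite i)   ≡⟨ cong [ r , l ∘ opposite ]′ (splitAt-↑ʳ (suc m) (suc m) (opposite i)) ⟩
    l (opposite (opposite i))             ≡⟨ cong l (opposite-involutive i) ⟩
    l i                                   ∎
    where open ≡-Reasoning

  InWindow : ℤ → Set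
  InWindow z = (Σ[ i ∈ Fin (suc m) ] z ≡ o + ι i mod M) ⊎ (Σ[ i ∈ Fin (suc m) ] z ≡ o - ι i - + 1 mod M)

  window : ∀ z → InWindow z
  window z = by-half (splitAt (suc m) x) (sym (join-splitAt (suc m) (suc m) x))
    where
      x : Fin M
      x = ⟦ z - o ⟧
      z≡ : z ≡ o + ι x mod M
      z≡ = mod-trans (mod-reflexive (restore z o)) (mod-+ (mod-refl {o}) (mod-sym (ι⟦⟧ (z - o))))
        where
          restore : ∀ z o → z ≡ o + (z - o)
          restore = solve-∀
      by-half : ∀ s → x ≡ join (suc m) (suc m) s → InWindow z
      by-half (inj₁ i) x≡ = inj₁ (i , mod-trans z≡ (mod-reflexive
        (trans (cong (λ t → o + ι t) x≡) (cong (λ t → o + + t) (toℕ-↑ˡ i (suc m))))))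
      by-half (inj₂ j) x≡ = inj₂ (opposite j , mod-trans z≡ (mod-trans (mod-reflexive (cong (λ t → o + ι t) x≡))
        (upper-residue (opposite j) j (trans (+ℤ-comm (ι (opposite j)) (ι j)) (opposite-sum j)))))

  colour-unique : (f : ℤ → Colour m) → (∀ {a b} → a ≡ b mod M → f a ≡ f b) →
                  (∀ i → f (o + ι i) ≡ r i) → (∀ i → f (o - ι i - + 1) ≡ l i) →
                  ∀ z → f z ≡ colour z
  colour-unique f f-cong f-right f-left z with window z
  ... | inj₁ (i , h) = trans (f-cong h) (trans (f-right i) (sym (trans (colour-cong {z} h) (colour-right i))))
  ... | inj₂ (i , h) = trans (f-cong h) (trans (f-left i) (sym (trans (colour-cong {z} h) (colour-left i))))

half-odd : ∀ p → ⌊ 2 * p +ℕ 1 /2⌋ ≡ p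
half-odd zero = refl
half-odd (suc p) = trans (cong ⌊_/2⌋ (expand p)) (cong suc (half-odd p))
  where
    expand : ∀ p → 2 * suc p +ℕ 1 ≡ suc (suc (2 * p +ℕ 1))
    expand = ℕ-Solver.solve-∀

module Circulant (m k : ℕ) (2≤k : 2 ≤ k) .{{_ : NonZero (2 * suc m * k)}}
                 (v0 : Fin (2 * suc m * k)) where

  n : ℕ
  n = 2 * suc m * k

  open ResidueColouring m (ι v0)

  Adj : Fin n → Fin n → Set
  Adj = CircAdj n (U m)

  Colouring : Set
  Colouring = Fin n → Fin n → Colour m

  jump : ℕ → ℤ
  jump p = + (2 * p +ℕ 1)

  jump-expand : ∀ p → jump p ≡ + p + + p + + 1
  jump-expand p = double (+ p)
    where
      -- jump p unfolds to p + (p + 0) + 1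
      double : ∀ x → x + (x + + 0) + + 1 ≡ x + x + + 1
      double = solve-∀

  K : ℕ
  K = 2 * m +ℕ 1

  jump≤K : ∀ {p} → p ≤ m → 2 * p +ℕ 1 ≤ K
  jump≤K p≤m = ℕ.+-monoˡ-≤ 1 (ℕ.*-monoʳ-≤ 2 p≤m)

  K+K<n : K +ℕ K < n
  K+K<n = begin-strict
    K +ℕ K           <⟨ ℕ.n<1+n _ ⟩
    suc (K +ℕ K)     <⟨ ℕ.n<1+n _ ⟩
    2 +ℕ (K +ℕ K)    ≡⟨ four-m+4 m ⟩
    2 * suc m * 2    ≤⟨ ℕ.*-monoʳ-≤ (2 * suc m) 2≤k ⟩
    n                ∎
    where
      open ℕ.≤-Reasoning
      four-m+4 : ∀ m → 2 +ℕ ((2 * m +ℕ 1) +ℕ (2 * m +ℕ 1)) ≡ 2 * suc m * 2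
      four-m+4 = ℕ-Solver.solve-∀

  jump<n : ∀ {p} → p ≤ m → 2 * p +ℕ 1 < n
  jump<n p≤m = ℕ.≤-<-trans (ℕ.≤-trans (jump≤K p≤m) (ℕ.m≤m+n K K)) K+K<n

  1<n : 1 < n
  1<n = jump<n z≤n

  long-way-back : ∀ {p} → p ≤ m → ¬ (n ∸ (2 * p +ℕ 1) ≤ K)
  long-way-back p≤m h = ℕ.<⇒≱ K+K<n
    (subst (_≤ K +ℕ K) (ℕ.m∸n+n≡m (ℕ.<⇒≤ (jump<n p≤m))) (ℕ.+-mono-≤ h (jump≤K p≤m)))

  M≡2m+2 : M ≡ 2 * m +ℕ 2
  M≡2m+2 = double-suc m
    where
      double-suc : ∀ m → suc m +ℕ suc m ≡ 2 * m +ℕ 2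
      double-suc = ℕ-Solver.solve-∀

  past-full-turn : ∀ y → y + + (2 * m +ℕ 2) + + 1 ≡ y + + (2 * m +ℕ 3)
  past-full-turn y = trans (+ℤ-assoc y (+ (2 * m +ℕ 2)) (+ 1)) (cong (λ t → y + + t) (ℕ.+-assoc (2 * m) 2 1))

  -- M divides n
  mod-M : a ≡ b mod n → a ≡ b mod M
  mod-M = mod-divisor (divides k (M-times-k m k))
    where
      M-times-k : ∀ m k → 2 * suc m * k ≡ k * (suc m +ℕ suc m)
      M-times-k = ℕ-Solver.solve-∀

  edge-direction : ∀ {u v} → Adj u v →
                   Σ[ p ∈ ℕ ] p ≤ m × (ι v ≡ ι u + jump p mod n ⊎ ι u ≡ ι v + jump p mod n)
  edge-direction (_ , _ , (p , p≤m , refl) , inj₁ refl) = p , p≤m , inj₁ (ι⟦⟧ _)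
  edge-direction {u} (_ , _ , (p , p≤m , refl) , inj₂ refl) =
    p , p≤m , inj₂ (mod-trans (mod-reflexive (restore (ι u) (jump p))) (mod-+ (mod-sym (ι⟦⟧ (ι u - jump p))) mod-refl))
    where
      restore : ∀ a s → a ≡ a - s + s
      restore = solve-∀

  unit-edge-adjacent : ∀ z → Adj ⟦ z ⟧ ⟦ z + + 1 ⟧
  unit-edge-adjacent z = distinct , + 1 , (0 , z≤n , refl) , inj₁ (⟦⟧-cong (mod-+ (mod-sym (ι⟦⟧ z)) mod-refl))
    where
      distinct : ⟦ z ⟧ ≢ ⟦ z + + 1 ⟧
      distinct eq = 0≢1 (residue-unique (ℕ.<-trans (s≤s z≤n) 1<n) 1<n
                          (mod-cancelˡ {z} (mod-trans (mod-reflexive (+ℤ-identityʳ z)) (⟦⟧-reflects eq))))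
        where
          0≢1 : 0 ≢ 1
          0≢1 ()

  Centred : Colouring → Set
  Centred φ = ∀ {u v z p} → p ≤ m → ι u ≡ z mod n → ι v ≡ z + jump p mod n → φ u v ≡ colour (z + + p)

  unit-edge-colour : ∀ {φ} → Centred φ → ∀ {u v} z → ι u ≡ z mod n → ι v ≡ z + + 1 mod n → φ u v ≡ colour z
  unit-edge-colour centred z hu hv = trans (centred z≤n hu hv) (cong colour (+ℤ-identityʳ z))

  -- Under rules (i) and (ii) the unit edge from z to z + 1 has colour z: its
  -- colour is M-periodic in z by (ii) and prescribed on a window by (i).
  module UnitEdges (φ : Colouring) (rules : Rules m n v0 φ) where

    unit : ℤ → Colour m
    unit z = φ ⟦ z ⟧ ⟦ z + + 1 ⟧

    unit-cong : a ≡ b mod n → unit a ≡ unit b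
    unit-cong h = cong₂ φ (⟦⟧-cong h) (⟦⟧-cong (mod-+ h mod-refl))

    unit-at : (x : Fin n) → φ x ⟦ ι x + + 1 ⟧ ≡ unit (ι x)
    unit-at x = cong (λ y → φ y ⟦ ι x + + 1 ⟧) (sym (⟦ι⟧ x))

    unit-periodic : ∀ z → unit (z + + M) ≡ unit z
    unit-periodic z = begin
      unit (z + + M)                                       ≡⟨ unit-cong (mod-+ (mod-sym (ι⟦⟧ z)) (mod-reflexive (cong +_ M≡2m+2))) ⟩
      unit (ι x + + (2 * m +ℕ 2))                          ≡⟨ cong (φ _) (cong ⟦_⟧ (past-full-turn (ι x))) ⟩
      φ ⟦ ι x + + (2 * m +ℕ 2) ⟧ ⟦ ι x + + (2 * m +ℕ 3) ⟧  ≡⟨ proj₁ (proj₂ rules) x ⟩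
      φ x ⟦ ι x + + 1 ⟧                                    ≡⟨ unit-at x ⟩
      unit (ι x)                                           ≡⟨ unit-cong (ι⟦⟧ z) ⟩
      unit z                                               ∎
      where
        open ≡-Reasoning
        x : Fin n
        x = ⟦ z ⟧

    unit≡colour : ∀ z → unit z ≡ colour z
    unit≡colour = colour-unique unit (periodic-invariant unit unit-periodic) (proj₁ ∘ proj₁ rules)
      (λ i → trans (cong (φ _) (cong ⟦_⟧ (step (ι v0) (ι i)))) (proj₂ (proj₁ rules i)))
      where
        step : ∀ o i → o - i - + 1 + + 1 ≡ o - i
        step = solve-∀

  -- Any colouring obeying rules (i)–(iii) is centred: rule (iii) moves the
  -- colour of the unit edge from z + p to the edge from z to z + (2p+1).
  rules⇒centred : ∀ φ → Rules m n v0 φ → Centred φ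
  rules⇒centred φ rules@(_ , _ , rule-iii) {u} {v} {z} {p} p≤m hu hv = begin
    φ u v                               ≡⟨ cong₂ φ (sym (⟦⟧-at u left-end)) (sym (⟦⟧-at v right-end)) ⟩
    φ ⟦ ι w - + p ⟧ ⟦ ι w + + 1 + + p ⟧  ≡⟨ rule-iii w p p≤m ⟩
    φ w ⟦ ι w + + 1 ⟧                    ≡⟨ unit-at w ⟩
    unit (ι w)                          ≡⟨ unit-cong (ι⟦⟧ (z + + p)) ⟩
    unit (z + + p)                      ≡⟨ unit≡colour (z + + p) ⟩
    colour (z + + p)                    ∎
    where
      open ≡-Reasoning
      open UnitEdges φ rules

      w : Fin n
      w = ⟦ z + + p ⟧

      left-end : ι w - + p ≡ ι u mod n
      left-end = mod-trans (mod-+ (ι⟦⟧ (z + + p)) mod-refl) (mod-trans (mod-reflexive (cancel z (+ p))) (mod-sym hu))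
        where
          cancel : ∀ z p → z + p - p ≡ z
          cancel = solve-∀

      right-end : ι w + + 1 + + p ≡ ι v mod n
      right-end = mod-trans (mod-+ (mod-+ (ι⟦⟧ (z + + p)) mod-refl) mod-refl)
        (mod-trans (mod-reflexive (trans (regroup z (+ p)) (cong (λ t → z + t) (sym (jump-expand p))))) (mod-sym hv))
        where
          regroup : ∀ z p → z + p + + 1 + p ≡ z + (p + p + + 1)
          regroup = solve-∀

  -- Conversely a centred colouring obeys rules (i)–(iii): each rule compares
  -- edges whose centres are congruent modulo M.
  centred⇒rules : ∀ {φ} → Centred φ → Rules m n v0 φ
  centred⇒rules {φ} centred = rule-i , rule-ii , rule-iii
    where
      unit-edge : ∀ {u v} z → ι u ≡ z mod n → ι v ≡ z + + 1 mod n → φ u v ≡ colour z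
      unit-edge = unit-edge-colour centred

      rule-i : ∀ (i : Fin (suc m)) →
                 (φ ⟦ ι v0 + ι i ⟧ ⟦ ι v0 + ι i + + 1 ⟧ ≡ r i)
               × (φ ⟦ ι v0 - ι i - + 1 ⟧ ⟦ ι v0 - ι i ⟧ ≡ l i)
      rule-i i = trans (unit-edge (ι v0 + ι i) (ι⟦⟧ _) (ι⟦⟧ _)) (colour-right i)
               , trans (unit-edge (ι v0 - ι i - + 1) (ι⟦⟧ _) (mod-trans (ι⟦⟧ _) (mod-reflexive (sym (step (ι v0) (ι i))))))
                       (colour-left i)
        where
          step : ∀ o i → o - i - + 1 + + 1 ≡ o - i
          step = solve-∀

      rule-ii : ∀ (v : Fin n) → φ ⟦ ι v + + (2 * m +ℕ 2) ⟧ ⟦ ι v + + (2 * m +ℕ 3) ⟧ ≡ φ v ⟦ ι v + + 1 ⟧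
      rule-ii v = begin
        φ ⟦ ι v + + (2 * m +ℕ 2) ⟧ ⟦ ι v + + (2 * m +ℕ 3) ⟧  ≡⟨ unit-edge (ι v + + (2 * m +ℕ 2)) (ι⟦⟧ _) (mod-trans (ι⟦⟧ _) (mod-reflexive step)) ⟩
        colour (ι v + + (2 * m +ℕ 2))                        ≡⟨ colour-cong full-turn ⟩
        colour (ι v)                                         ≡⟨ unit-edge (ι v) mod-refl (ι⟦⟧ _) ⟨
        φ v ⟦ ι v + + 1 ⟧                                    ∎
        where
          open ≡-Reasoning
          step : ι v + + (2 * m +ℕ 3) ≡ ι v + + (2 * m +ℕ 2) + + 1
          step = sym (past-full-turn (ι v))
          full-turn : ι v + + (2 * m +ℕ 2) ≡ ι v mod M
          full-turn = by-multiple (+ 1) (cong (λ t → ι v + t) (trans (cong +_ (sym M≡2m+2)) (sym (*ℤ-identityˡ (+ M)))))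

      rule-iii : ∀ (v : Fin n) (p : ℕ) → p ≤ m → φ ⟦ ι v - + p ⟧ ⟦ ι v + + 1 + + p ⟧ ≡ φ v ⟦ ι v + + 1 ⟧
      rule-iii v p p≤m = begin
        φ ⟦ ι v - + p ⟧ ⟦ ι v + + 1 + + p ⟧  ≡⟨ centred p≤m (ι⟦⟧ (ι v - + p)) (mod-trans (ι⟦⟧ _) (mod-reflexive span)) ⟩
        colour (ι v - + p + + p)            ≡⟨ cong colour (cancel (ι v) (+ p)) ⟩
        colour (ι v)                        ≡⟨ unit-edge (ι v) mod-refl (ι⟦⟧ _) ⟨
        φ v ⟦ ι v + + 1 ⟧                    ∎
        where
          open ≡-Reasoning
          cancel : ∀ v p → v - p + p ≡ v
          cancel = solve-∀
          regroup : ∀ v p → v + + 1 + p ≡ v - p + (p + p + + 1)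
          regroup = solve-∀
          span : ι v + + 1 + + p ≡ ι v - + p + jump p
          span = trans (regroup (ι v) (+ p)) (cong (λ t → ι v - + p + t) (sym (jump-expand p)))

  -- Offsets t = a - (m+1) for a < M run through -(m+1) … m, distinct mod M.
  offset : ℕ → ℤ
  offset a = + a - + suc m

  offset-injective : ∀ {a b} → a < M → b < M → offset a ≡ offset b mod M → a ≡ b
  offset-injective {a} {b} a<M b<M h = residue-unique a<M b<M
    (mod-trans (mod-reflexive (restore (+ a) (+ suc m)))
      (mod-trans (mod-+ h mod-refl) (mod-reflexive (sym (restore (+ b) (+ suc m))))))
    where
      restore : ∀ x s → x ≡ x - s + s
      restore = solve-∀

  NeighbourAt : Colouring → Fin n → Fin n → ℕ → Set
  NeighbourAt φ u v a = a < M × ι v ≡ ι u + (offset a + offset a + + 1) mod n × φ u v ≡ colour (ι u + offset a)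

  forward-neighbour : ∀ {φ} → Centred φ → ∀ {u v p} → p ≤ m → ι v ≡ ι u + jump p mod n →
                      NeighbourAt φ u v (p +ℕ suc m)
  forward-neighbour centred {u} {v} {p} p≤m hv =
    ℕ.+-monoˡ-< (suc m) (s≤s p≤m) ,
    mod-trans hv (mod-reflexive (cong (λ t → ι u + t) (trans (jump-expand p) (cong (λ t → t + t + + 1) t≡)))) ,
    trans (centred p≤m mod-refl hv) (cong (λ t → colour (ι u + t)) t≡)
    where
      cancel : ∀ p s → p ≡ p + s - s
      cancel = solve-∀
      t≡ : + p ≡ offset (p +ℕ suc m)
      t≡ = cancel (+ p) (+ suc m)

  backward-neighbour : ∀ {φ} → Centred φ → IsEdgeColouring Adj φ → ∀ {u v p} → Adj u v → p ≤ m →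
                       ι u ≡ ι v + jump p mod n → NeighbourAt φ u v (m ∸ p)
  backward-neighbour {φ} centred symmetric {u} {v} {p} adj p≤m hu =
    ℕ.≤-<-trans (ℕ.m∸n≤m m p) (ℕ.≤-trans (ℕ.n<1+n m) (ℕ.m≤m+n (suc m) (suc m))) ,
    mod-trans v≡ (mod-reflexive (trans (cong (λ s → ι u - s) (jump-expand p)) (trans (twice (ι u) (+ p)) (cong (λ t → ι u + (t + t + + 1)) (sym t≡))))) ,
    (begin
      φ u v                          ≡⟨ symmetric u v adj ⟩
      φ v u                          ≡⟨ centred p≤m mod-refl hu ⟩
      colour (ι v + + p)             ≡⟨ colour-cong (mod-M (mod-+ v≡ mod-refl)) ⟩
      colour (ι u - jump p + + p)    ≡⟨ cong colour (trans (cong (λ s → ι u - s + + p) (jump-expand p)) (trans (once (ι u) (+ p)) (cong (λ t → ι u + t) (sym t≡)))) ⟩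
      colour (ι u + offset (m ∸ p))  ∎)
    where
      open ≡-Reasoning
      restore : ∀ v s → v ≡ v + s - s
      restore = solve-∀
      v≡ : ι v ≡ ι u - jump p mod n
      v≡ = mod-trans (mod-reflexive (restore (ι v) (jump p))) (mod-+ (mod-sym hu) (mod-refl { - jump p}))
      back : ∀ a p → a - (+ 1 + (p + a)) ≡ - p - + 1
      back = solve-∀
      t≡ : offset (m ∸ p) ≡ - + p - + 1
      t≡ = trans (cong (λ s → + (m ∸ p) - + suc s) (sym (ℕ.m+[n∸m]≡n p≤m))) (back (+ (m ∸ p)) (+ p))
      twice : ∀ u p → u - (p + p + + 1) ≡ u + ((- p - + 1) + (- p - + 1) + + 1)
      twice = solve-∀
      once : ∀ u p → u - (p + p + + 1) + p ≡ u + (- p - + 1)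
      once = solve-∀

  neighbour-offset : ∀ {φ} → Centred φ → IsEdgeColouring Adj φ → ∀ {u v} → Adj u v →
                     Σ[ a ∈ ℕ ] NeighbourAt φ u v a
  neighbour-offset centred symmetric adj with edge-direction adj
  ... | p , p≤m , inj₁ hv = p +ℕ suc m , forward-neighbour centred p≤m hv
  ... | p , p≤m , inj₂ hu = m ∸ p , backward-neighbour centred symmetric adj p≤m hu

  same-colour⇒same-neighbour : ∀ {φ u v w a b} → NeighbourAt φ u v a → NeighbourAt φ u w b →
                               φ u v ≡ φ u w → v ≡ w
  same-colour⇒same-neighbour {u = u} {v} {w} {a} {b} (a<M , hv , cv) (b<M , hw , cw) same =
    vertex-ext v w (mod-trans hv (mod-sym (subst (λ c → ι w ≡ ι u + (offset c + offset c + + 1) mod n) (sym a≡b) hw)))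
    where
      a≡b : a ≡ b
      a≡b = offset-injective a<M b<M (mod-cancelˡ {ι u} (colour-injective {ι u + offset a} {ι u + offset b} (trans (sym cv) (trans same cw))))

  centred⇒proper : ∀ {φ} → Centred φ → IsEdgeColouring Adj φ → IsProper Adj φ
  centred⇒proper {φ} centred symmetric u v w uv uw v≢w same =
    v≢w (same-colour⇒same-neighbour {φ} (proj₂ (neighbour-offset centred symmetric uv))
                                    (proj₂ (neighbour-offset centred symmetric uw)) same)

  on-unit-edge : ∀ {φ} → Centred φ → ∀ z {col} → colour z ≡ col → ∃[ u ] ∃[ v ] (Adj u v × φ u v ≡ col)
  on-unit-edge centred z eq = ⟦ z ⟧ , ⟦ z + + 1 ⟧ , unit-edge-adjacent z ,
                              trans (unit-edge-colour centred z (ι⟦⟧ z) (ι⟦⟧ (z + + 1))) eq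

  centred⇒uses-all : ∀ {φ} → Centred φ → UsesAll Adj φ
  centred⇒uses-all centred (inj₁ i) = on-unit-edge centred (ι v0 - ι i - + 1) (colour-left i)
  centred⇒uses-all centred (inj₂ i) = on-unit-edge centred (ι v0 + ι i) (colour-right i)

  dist : Fin n → Fin n → ℕ
  dist u v = toℕ (⟦_⟧ {n} (ι v - ι u))

  -- colour each edge from the endpoint at which it is short (length ≤ K)
  φ₀ : Colouring
  φ₀ u v with dist u v ≤? K
  ... | yes _ = colour (ι u + + ⌊ dist u v /2⌋)
  ... | no _  = colour (ι v + + ⌊ dist v u /2⌋)

  φ₀-short : ∀ {u v} → dist u v ≤ K → φ₀ u v ≡ colour (ι u + + ⌊ dist u v /2⌋)
  φ₀-short {u} {v} short with dist u v ≤? K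
  ... | yes _    = refl
  ... | no ¬short = contradiction short ¬short

  φ₀-long : ∀ {u v} → ¬ dist u v ≤ K → φ₀ u v ≡ colour (ι v + + ⌊ dist v u /2⌋)
  φ₀-long {u} {v} ¬short with dist u v ≤? K
  ... | yes short = contradiction short ¬short
  ... | no _      = refl

  jump-dist : ∀ {p u v} → p ≤ m → ι v ≡ ι u + jump p mod n →
              dist u v ≡ 2 * p +ℕ 1 × dist v u ≡ n ∸ (2 * p +ℕ 1)
  jump-dist {p} {u} {v} p≤m hv = toℕ⟦⟧ (jump<n p≤m) forward , toℕ⟦⟧ (ℕ.∸-monoʳ-< (ℕ.m≤n+m 1 (2 * p)) S≤n) backward
    where
      S≤n : 2 * p +ℕ 1 ≤ n
      S≤n = ℕ.<⇒≤ (jump<n p≤m)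
      cancel : ∀ u s → u + s - u ≡ s
      cancel = solve-∀
      forward : ι v - ι u ≡ jump p mod n
      forward = mod-trans (mod-+ hv (mod-refl { - ι u})) (mod-reflexive (cancel (ι u) (jump p)))
      negate : ∀ u s → u - (u + s) ≡ - s
      negate = solve-∀
      backward : ι u - ι v ≡ + (n ∸ (2 * p +ℕ 1)) mod n
      backward = mod-trans (mod-+ (mod-refl {ι u}) (mod-neg hv))
                   (mod-trans (mod-reflexive (negate (ι u) (jump p))) (mod-negate S≤n))

  φ₀-on-jump : ∀ {p u v} → p ≤ m → ι v ≡ ι u + jump p mod n →
               φ₀ u v ≡ colour (ι u + + p) × φ₀ v u ≡ colour (ι u + + p)
  φ₀-on-jump {p} {u} {v} p≤m hv = trans (φ₀-short short) from-u , trans (φ₀-long long) from-u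
    where
      distances : dist u v ≡ 2 * p +ℕ 1 × dist v u ≡ n ∸ (2 * p +ℕ 1)
      distances = jump-dist p≤m hv
      short : dist u v ≤ K
      short = subst (_≤ K) (sym (proj₁ distances)) (jump≤K p≤m)
      long : ¬ dist v u ≤ K
      long = subst (λ d → ¬ d ≤ K) (sym (proj₂ distances)) (long-way-back p≤m)
      from-u : colour (ι u + + ⌊ dist u v /2⌋) ≡ colour (ι u + + p)
      from-u = cong (λ d → colour (ι u + + d)) (trans (cong ⌊_/2⌋ (proj₁ distances)) (half-odd p))

  φ₀-symmetric : IsEdgeColouring Adj φ₀
  φ₀-symmetric u v adj with edge-direction adj
  ... | p , p≤m , inj₁ hv = trans (proj₁ (φ₀-on-jump p≤m hv)) (sym (proj₂ (φ₀-on-jump p≤m hv)))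
  ... | p , p≤m , inj₂ hu = trans (proj₂ (φ₀-on-jump p≤m hu)) (sym (proj₁ (φ₀-on-jump p≤m hu)))

  φ₀-centred : Centred φ₀
  φ₀-centred p≤m hu hv =
    trans (proj₁ (φ₀-on-jump p≤m (mod-trans hv (mod-+ (mod-sym hu) mod-refl))))
          (colour-cong (mod-M (mod-+ hu mod-refl)))

lemma1 : (m k : ℕ) → 2 ≤ k → .{{_ : NonZero (2 * suc m * k)}} →
         (v0 : Fin (2 * suc m * k)) →
         (∃[ φ ] (IsEdgeColouring (CircAdj (2 * suc m * k) (U m)) φ
                  × Rules m (2 * suc m * k) v0 φ))
         × (∀ (φ : Fin (2 * suc m * k) → Fin (2 * suc m * k) → Colour m) →
              IsEdgeColouring (CircAdj (2 * suc m * k) (U m)) φ →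
              Rules m (2 * suc m * k) v0 φ →
              IsProper (CircAdj (2 * suc m * k) (U m)) φ
              × UsesAll (CircAdj (2 * suc m * k) (U m)) φ)
lemma1 m k 2≤k v0 =
    (φ₀ , φ₀-symmetric , centred⇒rules φ₀-centred)
  , λ φ symmetric rules →
      let centred = rules⇒centred φ rules
      in centred⇒proper centred symmetric , centred⇒uses-all centred
  where open Circulant m k 2≤k v0
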